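{- In every valid Septoku board $s$, each symbol $k\in\{1,\dots,7\}$ satisfies $|s^{ -1}(k)|\ge 5$.
   Context: The Septoku board consists of 37 cells forming a regular hexagon of side 4 in a hexagonal grid, numbered row by row: $1$–$4$ (top row), $5$–$9$, $10$–$15$, $16$–$22$, $23$–$28$, $29$–$33$, $34$–$37$ (bottom row). The 21 "rows" of the board are: horizontal $\{1,2,3,4\}$, $\{5,\dots,9\}$, $\{10,\dots,15\}$, $\{16,\dots,22\}$, $\{23,\dots,28\}$, $\{29,\dots,33\}$, $\{34,\dots,37\}$; up-right $\{1,5,10,16\}$, $\{2,6,11,17,23\}$, $\{3,7,12,18,24,29\}$, $\{4,8,13,19,25,30,34\}$, $\{9,14,20,26,31,35\}$, $\{15,21,27,32,36\}$, $\{22,28,33,37\}$; down-right $\{4,9,15,22\}$, $\{3,8,14,21,28\}$, $\{2,7,13,20,27,33\}$, $\{1,6,12,19,26,32,37\}$, $\{5,11,18,25,31,36\}$, $\{10,17,24,30,35\}$, $\{16,23,29,34\}$. The seven "circles" are: $\{1,2,5,6,7,11,12\}$, $\{3,4,7,8,9,13,14\}$, $\{10,11,16,17,18,23,24\}$, $\{12,13,18,19,20,25,26\}$, $\{14,15,20,21,22,27,28\}$, $\{24,25,29,30,31,34,35\}$, $\{26,27,31,32,33,36,37\}$. A valid Septoku board is a map $s:\{1,\dots,37\}\to\{1,\dots,7\}$ such that the cells of each of the 21 rows receive pairwise distinct values and the seven cells of each circle receive pairwise distinct values. -}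

module Defs where

open import Data.Nat using (ℕ; suc; _≤_; _<_)
open import Data.Nat.Properties using (_<?_; ≤-pred)
open import Data.Product using (_×_)
open import Data.Fin using (Fin; _≟_; fromℕ<)
open import Data.List using (List; []; _∷_; map; filter; length; allFin)
open import Data.List.Relation.Unary.All using (All)
open import Data.List.Relation.Unary.AllPairs using (AllPairs)
open import Relation.Binary.PropositionalEquality using (_≡_; _≢_)
open import Relation.Nullary.Decidable using (True; toWitness)

-- Cells: Fin 37; paper cell number n (1..37) is  cell n  (= Fin element n - 1).
-- Symbols: Fin 7; paper symbol k (1..7) is the Fin 7 element k - 1.
Cell : Set
Cell = Fin 37

Symbol : Set
Symbol = Fin 7

Board : Set
Board = Cell → Symbol

cell : (n : ℕ) → {p : True (n <? 38)} → {q : True (0 <? n)} → Cell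
cell (suc m) {p} = fromℕ< {m} {37} (≤-pred (toWitness p))
cell 0 {q = ()}

rows : List (List Cell)
rows =
    (cell 1 ∷ cell 2 ∷ cell 3 ∷ cell 4 ∷ [])
  ∷ (cell 5 ∷ cell 6 ∷ cell 7 ∷ cell 8 ∷ cell 9 ∷ [])
  ∷ (cell 10 ∷ cell 11 ∷ cell 12 ∷ cell 13 ∷ cell 14 ∷ cell 15 ∷ [])
  ∷ (cell 16 ∷ cell 17 ∷ cell 18 ∷ cell 19 ∷ cell 20 ∷ cell 21 ∷ cell 22 ∷ [])
  ∷ (cell 23 ∷ cell 24 ∷ cell 25 ∷ cell 26 ∷ cell 27 ∷ cell 28 ∷ [])
  ∷ (cell 29 ∷ cell 30 ∷ cell 31 ∷ cell 32 ∷ cell 33 ∷ [])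
  ∷ (cell 34 ∷ cell 35 ∷ cell 36 ∷ cell 37 ∷ [])
  ∷ (cell 1 ∷ cell 5 ∷ cell 10 ∷ cell 16 ∷ [])
  ∷ (cell 2 ∷ cell 6 ∷ cell 11 ∷ cell 17 ∷ cell 23 ∷ [])
  ∷ (cell 3 ∷ cell 7 ∷ cell 12 ∷ cell 18 ∷ cell 24 ∷ cell 29 ∷ [])
  ∷ (cell 4 ∷ cell 8 ∷ cell 13 ∷ cell 19 ∷ cell 25 ∷ cell 30 ∷ cell 34 ∷ [])
  ∷ (cell 9 ∷ cell 14 ∷ cell 20 ∷ cell 26 ∷ cell 31 ∷ cell 35 ∷ [])
  ∷ (cell 15 ∷ cell 21 ∷ cell 27 ∷ cell 32 ∷ cell 36 ∷ [])
  ∷ (cell 22 ∷ cell 28 ∷ cell 33 ∷ cell 37 ∷ [])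
  ∷ (cell 4 ∷ cell 9 ∷ cell 15 ∷ cell 22 ∷ [])
  ∷ (cell 3 ∷ cell 8 ∷ cell 14 ∷ cell 21 ∷ cell 28 ∷ [])
  ∷ (cell 2 ∷ cell 7 ∷ cell 13 ∷ cell 20 ∷ cell 27 ∷ cell 33 ∷ [])
  ∷ (cell 1 ∷ cell 6 ∷ cell 12 ∷ cell 19 ∷ cell 26 ∷ cell 32 ∷ cell 37 ∷ [])
  ∷ (cell 5 ∷ cell 11 ∷ cell 18 ∷ cell 25 ∷ cell 31 ∷ cell 36 ∷ [])
  ∷ (cell 10 ∷ cell 17 ∷ cell 24 ∷ cell 30 ∷ cell 35 ∷ [])
  ∷ (cell 16 ∷ cell 23 ∷ cell 29 ∷ cell 34 ∷ [])
  ∷ []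

circles : List (List Cell)
circles =
    (cell 1 ∷ cell 2 ∷ cell 5 ∷ cell 6 ∷ cell 7 ∷ cell 11 ∷ cell 12 ∷ [])
  ∷ (cell 3 ∷ cell 4 ∷ cell 7 ∷ cell 8 ∷ cell 9 ∷ cell 13 ∷ cell 14 ∷ [])
  ∷ (cell 10 ∷ cell 11 ∷ cell 16 ∷ cell 17 ∷ cell 18 ∷ cell 23 ∷ cell 24 ∷ [])
  ∷ (cell 12 ∷ cell 13 ∷ cell 18 ∷ cell 19 ∷ cell 20 ∷ cell 25 ∷ cell 26 ∷ [])
  ∷ (cell 14 ∷ cell 15 ∷ cell 20 ∷ cell 21 ∷ cell 22 ∷ cell 27 ∷ cell 28 ∷ [])
  ∷ (cell 24 ∷ cell 25 ∷ cell 29 ∷ cell 30 ∷ cell 31 ∷ cell 34 ∷ cell 35 ∷ [])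
  ∷ (cell 26 ∷ cell 27 ∷ cell 31 ∷ cell 32 ∷ cell 33 ∷ cell 36 ∷ cell 37 ∷ [])
  ∷ []

Distinct : Board → List Cell → Set
Distinct s cs = AllPairs (λ x y → s x ≢ s y) cs

ValidBoard : Board → Set
ValidBoard s = All (Distinct s) rows × All (Distinct s) circles

preimageSize : Board → Symbol → ℕ
preimageSize s k = length (filter (λ x → s x ≟ k) (allFin 37))

-- Each circle consists of seven cells with distinct values, so it contains the
-- symbol k exactly once.  The seven circles cover the board, the twelve cells
-- 7, 11, 12, 13, 14, 18, 20, 24, 25, 26, 27, 31 twice and all others once, hence
-- 7 = |s⁻¹(k)| + (number of doubly covered cells carrying k).  Two distinct
-- cells sharing a row or circle carry different symbols, and among the doubly
-- covered cells any three contain such a pair; so at most two of them carry k.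
module Submission where

open import Defs
open import Data.Nat using (ℕ; suc; _+_; _≤_; _<_; z≤n; s≤s)
open import Data.Nat.Properties using (+-cancelʳ-≤; +-monoʳ-≤; ≤-antisym; ≤-reflexive; _<?_; module ≤-Reasoning)
open import Data.Fin as Fin using (Fin; zero; suc; punchOut; _≟_)
open import Data.Fin.Properties using (pigeonhole; punchOut-injective; ≤-decTotalOrder)
open import Data.List using (List; []; _∷_; _++_; concat; filter; length; lookup; allFin)
open import Data.List.Properties using (filter-++; length-++)
open import Data.List.Membership.Propositional using (_∈_)
open import Data.List.Membership.Propositional.Properties using (∈-lookup)
open import Data.List.Membership.DecPropositional (_≟_ {37}) using (_∈?_)
open import Data.List.Relation.Unary.All as All using (All; []; _∷_)
open import Data.List.Relation.Unary.All.Properties using (¬Any⇒All¬; ++⁺)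
open import Data.List.Relation.Unary.Any using (Any; here; there; any?)
open import Data.List.Relation.Unary.AllPairs as AllPairs using (AllPairs; []; _∷_; allPairs?)
open import Data.List.Relation.Binary.Permutation.Propositional using (_↭_; ↭-sym; ↭-trans)
open import Data.List.Relation.Binary.Permutation.Propositional.Properties using (↭-length; filter-↭)
open import Data.List.Sort.InsertionSort.Properties (≤-decTotalOrder 37) using (sort-↭)
open import Data.Product using (_×_; _,_)
open import Data.Sum using (_⊎_; inj₁; inj₂)
open import Data.Unit using (⊤; tt)
open import Data.Empty using (⊥-elim)
open import Relation.Nullary using (Dec; yes; no; ¬?; _×-dec_; _⊎-dec_)
open import Relation.Nullary.Decidable using (from-yes)
open import Relation.Binary.PropositionalEquality using (_≡_; _≢_; refl; sym; trans; cong; cong₂; ≢-sym)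

private
  variable
    A : Set

allPairs-lookup : ∀ {R : A → A → Set} {xs} → AllPairs R xs →
                  ∀ {i j} → i Fin.< j → R (lookup xs i) (lookup xs j)
allPairs-lookup (Rx ∷ _)  {zero}  {suc j} _           = All.lookup Rx (∈-lookup j)
allPairs-lookup (_ ∷ Rxs) {suc i} {suc j} (s≤s i<j) = allPairs-lookup Rxs i<j

allPairs-∈ : ∀ {R : A → A → Set} {xs x y} → AllPairs R xs →
             x ∈ xs → y ∈ xs → x ≢ y → R x y ⊎ R y x
allPairs-∈ _         (here refl) (here refl) x≢y = ⊥-elim (x≢y refl)
allPairs-∈ (Rx ∷ _)  (here refl) (there y∈) _   = inj₁ (All.lookup Rx y∈)
allPairs-∈ (Rx ∷ _)  (there x∈) (here refl) _   = inj₂ (All.lookup Rx x∈)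
allPairs-∈ (_ ∷ Rxs) (there x∈) (there y∈) x≢y = allPairs-∈ Rxs x∈ y∈ x≢y

AllTriples : (A → A → A → Set) → List A → Set
AllTriples T []       = ⊤
AllTriples T (x ∷ xs) = AllPairs (T x) xs × AllTriples T xs

allTriples? : {T : A → A → A → Set} → (∀ x y z → Dec (T x y z)) →
              ∀ xs → Dec (AllTriples T xs)
allTriples? T? []       = yes tt
allTriples? T? (x ∷ xs) = allPairs? (T? x) xs ×-dec allTriples? T? xs

distinct⇒hits : ∀ {m} (f : A → Fin (suc m)) {xs} →
                AllPairs (λ x y → f x ≢ f y) xs → m < length xs →
                ∀ k → Any (λ x → f x ≡ k) xs
distinct⇒hits f {xs} distinct m<len k with any? (λ x → f x ≟ k) xs
... | yes hit  = hit
... | no  miss =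
  let (i , j , i<j , gi≡gj) = pigeonhole m<len (λ i → punchOut (avoids i))
  in  ⊥-elim (allPairs-lookup distinct i<j (punchOut-injective (avoids i) (avoids j) gi≡gj))
  where
  avoids : ∀ i → k ≢ f (lookup xs i)
  avoids i k≡fx = All.lookup (¬Any⇒All¬ xs miss) (∈-lookup i) (sym k≡fx)

module Count {n} (f : A → Fin n) (k : Fin n) where

  count : List A → ℕ
  count xs = length (filter (λ x → f x ≟ k) xs)

  count-++ : ∀ xs ys → count (xs ++ ys) ≡ count xs + count ys
  count-++ xs ys = trans (cong length (filter-++ (λ x → f x ≟ k) xs ys))
                         (length-++ (filter (λ x → f x ≟ k) xs))

  count-↭ : ∀ {xs ys} → xs ↭ ys → count xs ≡ count ys
  count-↭ xs↭ys = ↭-length (filter-↭ (λ x → f x ≟ k) xs↭ys)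

  count-concat : ∀ {xss} → All (λ xs → count xs ≡ 1) xss → count (concat xss) ≡ length xss
  count-concat {[]}       []           = refl
  count-concat {xs ∷ xss} (once ∷ all) =
    trans (count-++ xs (concat xss)) (cong₂ _+_ once (count-concat all))

  count-absent : ∀ {xs} → All (λ x → f x ≢ k) xs → count xs ≡ 0
  count-absent {[]}     []          = refl
  count-absent {x ∷ xs} (fx≢k ∷ rest) with f x ≟ k
  ... | yes fx≡k = ⊥-elim (fx≢k fx≡k)
  ... | no  _    = count-absent rest

  count≥1 : ∀ {xs} → Any (λ x → f x ≡ k) xs → 1 ≤ count xs
  count≥1 {x ∷ xs} hit with f x ≟ k | hit
  ... | yes _    | _          = s≤s z≤n
  ... | no  fx≢k | here fx≡k  = ⊥-elim (fx≢k fx≡k)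
  ... | no  _    | there hit′ = count≥1 hit′

  count≤1 : ∀ {xs} → AllPairs (λ x y → f x ≡ k → f y ≢ k) xs → count xs ≤ 1
  count≤1 {[]}     []                = z≤n
  count≤1 {x ∷ xs} (excludes ∷ rest) with f x ≟ k
  ... | yes fx≡k = s≤s (≤-reflexive (count-absent (All.map (λ excl → excl fx≡k) excludes)))
  ... | no  _    = count≤1 rest

  count≤2 : ∀ {R : A → A → Set} → (∀ {x y} → R x y → f x ≢ f y) →
            ∀ {xs} → AllTriples (λ x y z → R x y ⊎ R x z ⊎ R y z) xs → count xs ≤ 2
  count≤2 differ {[]}     tt             = z≤n
  count≤2 {R} differ {x ∷ xs} (pairs , rest) with f x ≟ k
  ... | yes fx≡k = s≤s (count≤1 (AllPairs.map excludes pairs))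
    where
    excludes : ∀ {y z} → R x y ⊎ R x z ⊎ R y z → f y ≡ k → f z ≢ k
    excludes (inj₁ Rxy)        fy≡k _    = differ Rxy (trans fx≡k (sym fy≡k))
    excludes (inj₂ (inj₁ Rxz)) _    fz≡k = differ Rxz (trans fx≡k (sym fz≡k))
    excludes (inj₂ (inj₂ Ryz)) fy≡k fz≡k = differ Ryz (trans fy≡k (sym fz≡k))
  ... | no  _    = count≤2 differ rest

distinct⇒count≡1 : ∀ {m} (f : A → Fin (suc m)) k {xs} →
                   AllPairs (λ x y → f x ≢ f y) xs → m < length xs → Count.count f k xs ≡ 1
distinct⇒count≡1 f k distinct m<len =
  ≤-antisym (count≤1 (AllPairs.map excludes distinct))
            (count≥1 (distinct⇒hits f distinct m<len k))
  where
  open Count f k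
  excludes : ∀ {x y} → f x ≢ f y → f x ≡ k → f y ≢ k
  excludes fx≢fy fx≡k fy≡k = fx≢fy (trans fx≡k (sym fy≡k))

lines : List (List Cell)
lines = rows ++ circles

Peers : Cell → Cell → Set
Peers x y = x ≢ y × Any (λ L → x ∈ L × y ∈ L) lines

peers? : ∀ x y → Dec (Peers x y)
peers? x y = ¬? (x ≟ y) ×-dec any? (λ L → (x ∈? L) ×-dec (y ∈? L)) lines

peers-differ : ∀ {s x y} → ValidBoard s → Peers x y → s x ≢ s y
peers-differ {s} {x} {y} (rowsDistinct , circlesDistinct) (x≢y , shared) =
  All.lookupWith differ (++⁺ rowsDistinct circlesDistinct) shared
  where
  differ : ∀ {L} → Distinct s L → x ∈ L × y ∈ L → s x ≢ s y
  differ distinct (x∈ , y∈) with allPairs-∈ distinct x∈ y∈ x≢y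
  ... | inj₁ sx≢sy = sx≢sy
  ... | inj₂ sy≢sx = ≢-sym sy≢sx

doublyCovered : List Cell
doublyCovered =
  cell 7 ∷ cell 11 ∷ cell 12 ∷ cell 13 ∷ cell 14 ∷ cell 18 ∷
  cell 20 ∷ cell 24 ∷ cell 25 ∷ cell 26 ∷ cell 27 ∷ cell 31 ∷ []

-- Both sides reduce to the same sorted list.
circles-cover : concat circles ↭ allFin 37 ++ doublyCovered
circles-cover = ↭-trans (↭-sym (sort-↭ (concat circles))) (sort-↭ (allFin 37 ++ doublyCovered))

NoIndependentTriple : List Cell → Set
NoIndependentTriple = AllTriples (λ x y z → Peers x y ⊎ Peers x z ⊎ Peers y z)

doublyCovered-noIndependentTriple : NoIndependentTriple doublyCovered
doublyCovered-noIndependentTriple =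
  from-yes (allTriples? (λ x y z → peers? x y ⊎-dec peers? x z ⊎-dec peers? y z) doublyCovered)

theorem3 : (s : Board) → ValidBoard s → (k : Symbol) → 5 ≤ preimageSize s k
theorem3 s valid@(_ , circlesDistinct) k =
  +-cancelʳ-≤ 2 5 (count (allFin 37)) (begin
    7                                             ≡⟨ sym (count-concat circles-once) ⟩
    count (concat circles)                        ≡⟨ count-↭ circles-cover ⟩
    count (allFin 37 ++ doublyCovered)            ≡⟨ count-++ (allFin 37) doublyCovered ⟩
    count (allFin 37) + count doublyCovered       ≤⟨ +-monoʳ-≤ (count (allFin 37)) doublyCovered≤2 ⟩
    count (allFin 37) + 2                         ∎)
  where
  open Count s k
  open ≤-Reasoning

  circles-once : All (λ c → count c ≡ 1) circles
  circles-once = All.zipWith (λ (distinct , large) → distinct⇒count≡1 s k distinct large)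
                             (circlesDistinct , from-yes (All.all? (λ c → 6 <? length c) circles))

  doublyCovered≤2 : count doublyCovered ≤ 2
  doublyCovered≤2 = count≤2 (peers-differ valid) doublyCovered-noIndependentTriple
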